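{- In every c-quantale in which $x\cdot(y\cdot z)=(x\cdot y)\cdot z$ holds for all elements, for every $x$: $x^\ast=\nu(x)^\ast\cdot(1_\sigma+\tau(x))$, where $\tau(x)=x\cdot 0$ and $\nu(x)=x\sqcap\overline{1}_\pi$.
   Context: A proto-quantale is $(Q,\le,\cdot)$ with $(Q,\le)$ a complete lattice, $x\le y\Rightarrow z\cdot x\le z\cdot y$, and $(\sum_{i\in I}x_i)\cdot y=\sum_{i\in I}(x_i\cdot y)$; it is unital with unit $1$ if $1\cdot x=x=x\cdot 1$. A (commutative) quantale additionally has associative (commutative) multiplication and $x\cdot\sum_i y_i=\sum_i x\cdot y_i$. A proto-bi-quantale is $(Q,\le,\cdot,\|,1_\sigma,1_\pi)$ with $(Q,\le,\cdot,1_\sigma)$ a unital proto-quantale and $(Q,\le,\|,1_\pi)$ a unital commutative quantale. A c-quantale is a proto-bi-quantale which, with $+$ the binary supremum, $\sqcap$ the binary infimum, $0$ the least and $U$ the greatest element and a distinguished element $\overline{1}_\pi$, is a c-lattice: $(Q,+,\sqcap,0,U)$ is distributive and for all $x,y,z$: (cl1) $x\cdot 1_\pi+x\cdot\overline{1}_\pi=x\cdot U$; (cl2) $1_\pi\sqcap(x+\overline{1}_\pi)=x\cdot 0$; (cl3) $x\cdot(y\|z)\le(x\cdot y)\|(x\cdot z)$; (cl4) $z\|z\le z\Rightarrow (x\|y)\cdot z=(x\cdot z)\|(y\cdot z)$; (cl5) $x\cdot(y\cdot(z\cdot 0))=(x\cdot y)\cdot(z\cdot 0)$; (cl6) $(x\cdot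 0)\cdot y=x\cdot(0\cdot y)$; (cl7) $1_\sigma\|1_\sigma=1_\sigma$; (cl8) $((x\cdot 1_\pi)\|1_\sigma)\cdot y=(x\cdot 1_\pi)\|y$; (cl9) $((x\sqcap 1_\sigma)\cdot 1_\pi)\|1_\sigma=x\sqcap 1_\sigma$; (cl10) $((x\sqcap\overline{1}_\pi)\cdot 1_\pi)\|1_\sigma=1_\sigma\sqcap((x\sqcap\overline{1}_\pi)\cdot\overline{1}_\pi)$; (cl11) $((x\sqcap\overline{1}_\pi)\cdot 1_\pi)\|\overline{1}_\pi=(x\sqcap\overline{1}_\pi)\cdot\overline{1}_\pi$. For an element $x$, $x^\ast$ denotes the least fixpoint of the isotone map $y\mapsto 1_\sigma+x\cdot y$. -}

module Defs where

open import Level using (Level; suc; Lift; lift; lower)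
open import Data.Bool using (Bool; true; false; if_then_else_)
open import Data.Empty using (⊥; ⊥-elim)
open import Data.Product using (Σ; _×_; proj₁)
open import Relation.Binary.PropositionalEquality using (_≡_)

-- The carrier is a complete lattice whose
-- equality is propositional equality; arbitrary suprema ⋁ are taken over
-- families indexed by types in the same universe as the carrier (this covers
-- all subsets of the carrier).
record CQuantale (a : Level) : Set (suc a) where
  infixr 7 _·_
  infixr 6 _∥_
  infixl 5 _+_
  infixl 6 _⊓_
  infix 4 _≤_
  field
    Carrier : Set a
    _≤_     : Carrier → Carrier → Set a
    ≤-refl    : ∀ {x} → x ≤ x
    ≤-trans   : ∀ {x y z} → x ≤ y → y ≤ z → x ≤ z
    ≤-antisym : ∀ {x y} → x ≤ y → y ≤ x → x ≡ y
    ⋁       : {I : Set a} → (I → Carrier) → Carrier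
    ⋁-upper : {I : Set a} (f : I → Carrier) (i : I) → f i ≤ ⋁ f
    ⋁-least : {I : Set a} (f : I → Carrier) (z : Carrier) →
              (∀ i → f i ≤ z) → ⋁ f ≤ z

  _+_ : Carrier → Carrier → Carrier
  x + y = ⋁ {I = Lift a Bool} (λ b → if lower b then x else y)
  𝟘 : Carrier
  𝟘 = ⋁ {I = Lift a ⊥} (λ e → ⊥-elim (lower e))
  U : Carrier
  U = ⋁ {I = Carrier} (λ x → x)
  _⊓_ : Carrier → Carrier → Carrier
  x ⊓ y = ⋁ {I = Σ Carrier (λ z → (z ≤ x) × (z ≤ y))} proj₁

  field
    _·_ : Carrier → Carrier → Carrier
    _∥_ : Carrier → Carrier → Carrier
    1σ  : Carrier
    1π  : Carrier
    1̄π  : Carrier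
    ·-monoʳ    : ∀ {x y} z → x ≤ y → z · x ≤ z · y
    ·-distribʳ : {I : Set a} (f : I → Carrier) (y : Carrier) →
                 (⋁ f) · y ≡ ⋁ (λ i → f i · y)
    ·-identityˡ : ∀ x → 1σ · x ≡ x
    ·-identityʳ : ∀ x → x · 1σ ≡ x
    ∥-assoc     : ∀ x y z → (x ∥ y) ∥ z ≡ x ∥ (y ∥ z)
    ∥-comm      : ∀ x y → x ∥ y ≡ y ∥ x
    ∥-distribʳ  : {I : Set a} (f : I → Carrier) (y : Carrier) →
                  (⋁ f) ∥ y ≡ ⋁ (λ i → f i ∥ y)
    ∥-distribˡ  : {I : Set a} (x : Carrier) (f : I → Carrier) →
                  x ∥ (⋁ f) ≡ ⋁ (λ i → x ∥ f i)
    ∥-identityˡ : ∀ x → 1π ∥ x ≡ x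
    ∥-identityʳ : ∀ x → x ∥ 1π ≡ x
    distrib : ∀ x y z → x ⊓ (y + z) ≡ (x ⊓ y) + (x ⊓ z)
    cl1  : ∀ x → x · 1π + x · 1̄π ≡ x · U
    cl2  : ∀ x → 1π ⊓ (x + 1̄π) ≡ x · 𝟘
    cl3  : ∀ x y z → x · (y ∥ z) ≤ (x · y) ∥ (x · z)
    cl4  : ∀ x y z → z ∥ z ≤ z → (x ∥ y) · z ≡ (x · z) ∥ (y · z)
    cl5  : ∀ x y z → x · (y · (z · 𝟘)) ≡ (x · y) · (z · 𝟘)
    cl6  : ∀ x y → (x · 𝟘) · y ≡ x · (𝟘 · y)
    cl7  : 1σ ∥ 1σ ≡ 1σ
    cl8  : ∀ x y → ((x · 1π) ∥ 1σ) · y ≡ (x · 1π) ∥ y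
    cl9  : ∀ x → ((x ⊓ 1σ) · 1π) ∥ 1σ ≡ x ⊓ 1σ
    cl10 : ∀ x → ((x ⊓ 1̄π) · 1π) ∥ 1σ ≡ 1σ ⊓ ((x ⊓ 1̄π) · 1̄π)
    cl11 : ∀ x → ((x ⊓ 1̄π) · 1π) ∥ 1̄π ≡ (x ⊓ 1̄π) · 1̄π

  τ : Carrier → Carrier
  τ x = x · 𝟘

  ν : Carrier → Carrier
  ν x = x ⊓ 1̄π

  -- s is the least fixpoint of y ↦ 1σ + x · y, i.e. s = x*
  IsStar : Carrier → Carrier → Set a
  IsStar x s = (1σ + x · s ≡ s) × (∀ y → 1σ + x · y ≡ y → s ≤ y)

-- Every x splits as x = ν x + τ x, and τ x = x · 0 is a left zero of ·, so
-- x · w = ν x · w + τ x.  With associativity this makes ν(x)* · (1σ + τ x) a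
-- fixpoint of w ↦ 1σ + x · w, hence x* ≤ ν(x)* · (1σ + τ x).  Conversely the
-- right residual x* / (1σ + τ x) is a prefixpoint of w ↦ 1σ + ν x · w, so by
-- Knaster–Tarski ν(x)* lies below it, i.e. ν(x)* · (1σ + τ x) ≤ x*.
module Submission where

open import Defs
open import Level using (lift; lower)
open import Data.Bool using (true; false)
open import Data.Empty using (⊥-elim)
open import Data.Product using (Σ; _,_; proj₁; proj₂)
open import Relation.Binary.Bundles using (Poset)
open import Relation.Binary.PropositionalEquality
  using (_≡_; refl; sym; trans; cong; cong₂; isEquivalence; module ≡-Reasoning)
import Algebra.Definitions as AlgebraDefinitions
import Relation.Binary.Reasoning.PartialOrder as PosetReasoning

module CQuantaleProperties {a} (Q : CQuantale a) where
  open CQuantale Q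
  open AlgebraDefinitions {A = Carrier} _≡_
    using (Commutative; Associative; LeftIdentity; RightIdentity; LeftZero)

  poset : Poset a a a
  poset = record
    { Carrier = Carrier
    ; _≈_ = _≡_
    ; _≤_ = _≤_
    ; isPartialOrder = record
      { isPreorder = record
        { isEquivalence = isEquivalence
        ; reflexive = λ { refl → ≤-refl }
        ; trans = ≤-trans
        }
      ; antisym = ≤-antisym
      }
    }

  open Poset poset using (reflexive)

  x≤x+y : ∀ x y → x ≤ x + y
  x≤x+y _ _ = ⋁-upper _ (lift true)

  y≤x+y : ∀ x y → y ≤ x + y
  y≤x+y _ _ = ⋁-upper _ (lift false)

  +-least : ∀ {x y z} → x ≤ z → y ≤ z → x + y ≤ z
  +-least {z = z} x≤z y≤z = ⋁-least _ z λ { (lift true) → x≤z ; (lift false) → y≤z }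

  +-mono : ∀ {x y u v} → x ≤ u → y ≤ v → x + y ≤ u + v
  +-mono x≤u y≤v = +-least (≤-trans x≤u (x≤x+y _ _)) (≤-trans y≤v (y≤x+y _ _))

  +-comm : Commutative _+_
  +-comm x y = ≤-antisym (+-least (y≤x+y y x) (x≤x+y y x)) (+-least (y≤x+y x y) (x≤x+y x y))

  +-assoc : Associative _+_
  +-assoc x y z = ≤-antisym
    (+-least (+-mono ≤-refl (x≤x+y y z)) (≤-trans (y≤x+y y z) (y≤x+y x (y + z))))
    (+-least (≤-trans (x≤x+y x y) (x≤x+y (x + y) z)) (+-mono (y≤x+y x y) ≤-refl))

  𝟘-minimum : ∀ x → 𝟘 ≤ x
  𝟘-minimum x = ⋁-least _ x λ e → ⊥-elim (lower e)

  U-maximum : ∀ x → x ≤ U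
  U-maximum x = ⋁-upper (λ y → y) x

  +-identityˡ : LeftIdentity 𝟘 _+_
  +-identityˡ x = ≤-antisym (+-least (𝟘-minimum x) ≤-refl) (y≤x+y 𝟘 x)

  +-identityʳ : RightIdentity 𝟘 _+_
  +-identityʳ x = ≤-antisym (+-least ≤-refl (𝟘-minimum x)) (x≤x+y x 𝟘)

  x⊓y≤x : ∀ x y → x ⊓ y ≤ x
  x⊓y≤x x _ = ⋁-least _ x λ w → proj₁ (proj₂ w)

  x⊓y≤y : ∀ x y → x ⊓ y ≤ y
  x⊓y≤y _ y = ⋁-least _ y λ w → proj₂ (proj₂ w)

  ⊓-greatest : ∀ {x y z} → z ≤ x → z ≤ y → z ≤ x ⊓ y
  ⊓-greatest {z = z} z≤x z≤y = ⋁-upper proj₁ (z , z≤x , z≤y)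

  ⊓-comm : Commutative _⊓_
  ⊓-comm x y = ≤-antisym (⊓-greatest (x⊓y≤y x y) (x⊓y≤x x y)) (⊓-greatest (x⊓y≤y y x) (x⊓y≤x y x))

  ⊓-identityʳ : RightIdentity U _⊓_
  ⊓-identityʳ x = ≤-antisym (x⊓y≤x x U) (⊓-greatest ≤-refl (U-maximum x))

  ⋀ : (Carrier → Set a) → Carrier
  ⋀ P = ⋁ {I = Σ Carrier (λ w → ∀ p → P p → w ≤ p)} proj₁

  ⋀-lower : ∀ {P p} → P p → ⋀ P ≤ p
  ⋀-lower {p = p} Pp = ⋁-least _ p λ w → proj₂ w p Pp

  ⋀-greatest : ∀ {P w} → (∀ p → P p → w ≤ p) → w ≤ ⋀ P
  ⋀-greatest {w = w} lower = ⋁-upper proj₁ (w , lower)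

  module KnasterTarski (f : Carrier → Carrier) (f-mono : ∀ {x y} → x ≤ y → f x ≤ f y) where

    lfp : Carrier
    lfp = ⋀ (λ p → f p ≤ p)

    lfp-least : ∀ {z} → f z ≤ z → lfp ≤ z
    lfp-least = ⋀-lower

    f-lfp≤lfp : f lfp ≤ lfp
    f-lfp≤lfp = ⋀-greatest λ p fp≤p → ≤-trans (f-mono (lfp-least fp≤p)) fp≤p

    lfp-fixpoint : f lfp ≡ lfp
    lfp-fixpoint = ≤-antisym f-lfp≤lfp (lfp-least (f-mono f-lfp≤lfp))

  star-least : ∀ {x s z} → IsStar x s → 1σ + x · z ≤ z → s ≤ z
  star-least {x} (_ , s-least) prefix = ≤-trans (s-least lfp lfp-fixpoint) (lfp-least prefix)
    where open KnasterTarski (λ y → 1σ + x · y) (λ y≤z → +-mono ≤-refl (·-monoʳ x y≤z))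

  star-prefixpoint : ∀ {x s} → IsStar x s → 1σ + x · s ≤ s
  star-prefixpoint (s-fixpoint , _) = reflexive s-fixpoint

  ·-distribʳ-+ : ∀ x y z → (x + y) · z ≡ x · z + y · z
  ·-distribʳ-+ x y z = trans (·-distribʳ _ z) (≤-antisym
    (⋁-least _ _ λ { (lift true) → x≤x+y _ _ ; (lift false) → y≤x+y _ _ })
    (+-least (⋁-upper _ (lift true)) (⋁-upper _ (lift false))))

  ·-monoˡ : ∀ {x y} z → x ≤ y → x · z ≤ y · z
  ·-monoˡ {x} {y} z x≤y = begin
    x · z          ≤⟨ x≤x+y _ _ ⟩
    x · z + y · z  ≡⟨ ·-distribʳ-+ x y z ⟨
    (x + y) · z    ≡⟨ cong (_· z) (≤-antisym (+-least x≤y ≤-refl) (y≤x+y x y)) ⟩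
    y · z          ∎
    where open PosetReasoning poset

  ·-zeroˡ : LeftZero 𝟘 _·_
  ·-zeroˡ z = ≤-antisym
    (≤-trans (reflexive (·-distribʳ _ z)) (⋁-least _ 𝟘 λ e → ⊥-elim (lower e)))
    (𝟘-minimum _)

  _/_ : Carrier → Carrier → Carrier
  b / c = ⋁ {I = Σ Carrier (λ w → w · c ≤ b)} proj₁

  /-elim : ∀ b c → (b / c) · c ≤ b
  /-elim b c = ≤-trans (reflexive (·-distribʳ proj₁ c)) (⋁-least _ b proj₂)

  /-intro : ∀ {w b c} → w · c ≤ b → w ≤ b / c
  /-intro {w} wc≤b = ⋁-upper proj₁ (w , wc≤b)

  1π+1̄π≡U : 1π + 1̄π ≡ U
  1π+1̄π≡U = begin
    1π + 1̄π              ≡⟨ cong₂ _+_ (·-identityˡ 1π) (·-identityˡ 1̄π) ⟨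
    1σ · 1π + 1σ · 1̄π    ≡⟨ cl1 1σ ⟩
    1σ · U               ≡⟨ ·-identityˡ U ⟩
    U                    ∎
    where open ≡-Reasoning

  1π⊓1̄π≡𝟘 : 1π ⊓ 1̄π ≡ 𝟘
  1π⊓1̄π≡𝟘 = begin
    1π ⊓ 1̄π         ≡⟨ cong (1π ⊓_) (+-identityˡ 1̄π) ⟨
    1π ⊓ (𝟘 + 1̄π)   ≡⟨ cl2 𝟘 ⟩
    𝟘 · 𝟘           ≡⟨ ·-zeroˡ 𝟘 ⟩
    𝟘               ∎
    where open ≡-Reasoning

  τ≡⊓1π : ∀ x → τ x ≡ x ⊓ 1π
  τ≡⊓1π x = begin
    x · 𝟘                   ≡⟨ cl2 x ⟨
    1π ⊓ (x + 1̄π)           ≡⟨ distrib 1π x 1̄π ⟩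
    1π ⊓ x + 1π ⊓ 1̄π        ≡⟨ cong (1π ⊓ x +_) 1π⊓1̄π≡𝟘 ⟩
    1π ⊓ x + 𝟘              ≡⟨ +-identityʳ (1π ⊓ x) ⟩
    1π ⊓ x                  ≡⟨ ⊓-comm 1π x ⟩
    x ⊓ 1π                  ∎
    where open ≡-Reasoning

  ν+τ-decomposition : ∀ x → x ≡ ν x + τ x
  ν+τ-decomposition x = begin
    x                       ≡⟨ ⊓-identityʳ x ⟨
    x ⊓ U                   ≡⟨ cong (x ⊓_) 1π+1̄π≡U ⟨
    x ⊓ (1π + 1̄π)           ≡⟨ distrib x 1π 1̄π ⟩
    x ⊓ 1π + x ⊓ 1̄π         ≡⟨ +-comm (x ⊓ 1π) (x ⊓ 1̄π) ⟩
    x ⊓ 1̄π + x ⊓ 1π         ≡⟨ cong (ν x +_) (τ≡⊓1π x) ⟨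
    ν x + τ x               ∎
    where open ≡-Reasoning

  τ-leftZero : ∀ x → LeftZero (τ x) _·_
  τ-leftZero x z = begin
    (x · 𝟘) · z   ≡⟨ cl6 x z ⟩
    x · (𝟘 · z)   ≡⟨ cong (x ·_) (·-zeroˡ z) ⟩
    x · 𝟘         ∎
    where open ≡-Reasoning

  ·-ν+τ : ∀ x w → x · w ≡ ν x · w + τ x
  ·-ν+τ x w = begin
    x · w                   ≡⟨ cong (_· w) (ν+τ-decomposition x) ⟩
    (ν x + τ x) · w         ≡⟨ ·-distribʳ-+ (ν x) (τ x) w ⟩
    ν x · w + τ x · w       ≡⟨ cong (ν x · w +_) (τ-leftZero x w) ⟩
    ν x · w + τ x           ∎
    where open ≡-Reasoning

  module _ (·-assoc : ∀ x y z → x · (y · z) ≡ (x · y) · z) {x xs νxs : Carrier} where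

    ν-star·1σ+τ-fixpoint : IsStar (ν x) νxs →
                           1σ + x · (νxs · (1σ + τ x)) ≡ νxs · (1σ + τ x)
    ν-star·1σ+τ-fixpoint (νxs-fixpoint , _) = begin
      1σ + x · (νxs · c)               ≡⟨ cong (1σ +_) (·-ν+τ x (νxs · c)) ⟩
      1σ + (ν x · (νxs · c) + τ x)     ≡⟨ cong (λ w → 1σ + (w + τ x)) (·-assoc (ν x) νxs c) ⟩
      1σ + ((ν x · νxs) · c + τ x)     ≡⟨ cong (1σ +_) (+-comm _ (τ x)) ⟩
      1σ + (τ x + (ν x · νxs) · c)     ≡⟨ +-assoc 1σ (τ x) _ ⟨
      c + (ν x · νxs) · c              ≡⟨ cong (_+ (ν x · νxs) · c) (·-identityˡ c) ⟨
      1σ · c + (ν x · νxs) · c         ≡⟨ ·-distribʳ-+ 1σ (ν x · νxs) c ⟨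
      (1σ + ν x · νxs) · c             ≡⟨ cong (_· c) νxs-fixpoint ⟩
      νxs · c                          ∎
      where
        open ≡-Reasoning
        c = 1σ + τ x

    star≤ν-star·1σ+τ : IsStar x xs → IsStar (ν x) νxs → xs ≤ νxs · (1σ + τ x)
    star≤ν-star·1σ+τ (_ , xs-least) νxs-star = xs-least _ (ν-star·1σ+τ-fixpoint νxs-star)

    ν-star·1σ+τ≤star : IsStar x xs → IsStar (ν x) νxs → νxs · (1σ + τ x) ≤ xs
    ν-star·1σ+τ≤star xs-star νxs-star = begin
      νxs · c         ≤⟨ ·-monoˡ c (star-least νxs-star residual-prefixpoint) ⟩
      (xs / c) · c    ≤⟨ /-elim xs c ⟩
      xs              ∎
      where
        open PosetReasoning poset
        c = 1σ + τ x

        ν·xs+τ≤xs : ν x · xs + τ x ≤ xs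
        ν·xs+τ≤xs = ≤-trans (≤-trans (reflexive (sym (·-ν+τ x xs))) (y≤x+y 1σ (x · xs)))
                          (star-prefixpoint xs-star)

        c≤xs : c ≤ xs
        c≤xs = +-least (≤-trans (x≤x+y 1σ (x · xs)) (star-prefixpoint xs-star))
                       (≤-trans (y≤x+y _ (τ x)) ν·xs+τ≤xs)

        residual-prefixpoint : 1σ + ν x · (xs / c) ≤ xs / c
        residual-prefixpoint = /-intro (begin
          (1σ + ν x · (xs / c)) · c        ≡⟨ ·-distribʳ-+ 1σ _ c ⟩
          1σ · c + (ν x · (xs / c)) · c    ≡⟨ cong₂ _+_ (·-identityˡ c) (sym (·-assoc (ν x) (xs / c) c)) ⟩
          c + ν x · ((xs / c) · c)         ≤⟨ +-mono c≤xs (·-monoʳ (ν x) (/-elim xs c)) ⟩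
          xs + ν x · xs                    ≤⟨ +-least ≤-refl (≤-trans (x≤x+y _ (τ x)) ν·xs+τ≤xs) ⟩
          xs                               ∎)

lemma56 : ∀ {a} (Q : CQuantale a) → let open CQuantale Q in
          (∀ x y z → x · (y · z) ≡ (x · y) · z) →
          ∀ x xs νxs → IsStar x xs → IsStar (ν x) νxs →
          xs ≡ νxs · (1σ + τ x)
lemma56 Q ·-assoc x xs νxs xs-star νxs-star = ≤-antisym
  (star≤ν-star·1σ+τ ·-assoc xs-star νxs-star)
  (ν-star·1σ+τ≤star ·-assoc xs-star νxs-star)
  where
    open CQuantale Q using (≤-antisym)
    open CQuantaleProperties Q
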